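{- For every positive integer $n$, the $n$-dimensional cube $Q_n$ satisfies $W(Q_n)=\frac{n(n+1)}{2}$, and $Q_n$ has an interval $t$-coloring if and only if $n\leq t\leq \frac{n(n+1)}{2}$.
   Context: All graphs are finite, undirected, without loops or multiple edges. An edge-coloring of a graph $G$ with colors $1,\ldots,t$ is an interval $t$-coloring if all $t$ colors are used, and the colors of the edges incident to each vertex of $G$ are distinct and form an interval of consecutive integers. A graph is interval colorable if it has an interval $t$-coloring for some positive integer $t$. For an interval colorable graph $G$, $W(G)$ denotes the greatest $t$ for which $G$ has an interval $t$-coloring. $Q_n$ is the Cartesian product of $n$ copies of $K_2$ (the $n$-dimensional hypercube). -}

module Defs where

open import Data.Nat using (ℕ; zero; suc; _+_; _*_; _≤_; _/_)
open import Data.Bool using (Bool; not)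
open import Data.Vec using (Vec; []; _∷_)
open import Data.Product using (Σ; _×_; ∃; ∃-syntax; _,_)
open import Relation.Binary.PropositionalEquality using (_≡_; _≢_)
import Relation.Binary.PropositionalEquality
open import Relation.Nullary using (¬_)
open import Level using (0ℓ) renaming (suc to lsuc)

record Graph : Set₁ where
  field
    Vertex  : Set
    Adj     : Vertex → Vertex → Set
    sym     : ∀ {x y} → Adj x y → Adj y x
    irrefl  : ∀ {x} → ¬ Adj x x

open Graph public

data Differ1 : {n : ℕ} → Vec Bool n → Vec Bool n → Set where
  here  : ∀ {n} {b c : Bool} (xs : Vec Bool n) → b ≢ c → Differ1 (b ∷ xs) (c ∷ xs)
  there : ∀ {n} b {xs ys : Vec Bool n} → Differ1 xs ys → Differ1 (b ∷ xs) (b ∷ ys)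

Differ1-sym : ∀ {n} {x y : Vec Bool n} → Differ1 x y → Differ1 y x
Differ1-sym (here xs ne) = here xs (λ e → ne (Relation.Binary.PropositionalEquality.sym e))
Differ1-sym (there b d) = there b (Differ1-sym d)

Differ1-irrefl : ∀ {n} {x : Vec Bool n} → ¬ Differ1 x x
Differ1-irrefl (here xs ne) = ne Relation.Binary.PropositionalEquality.refl
Differ1-irrefl (there b d) = Differ1-irrefl d

Q : ℕ → Graph
Q n = record
  { Vertex = Vec Bool n
  ; Adj = Differ1
  ; sym = Differ1-sym
  ; irrefl = Differ1-irrefl
  }

record IntervalColoring (G : Graph) (t : ℕ) : Set where
  field
    col       : ∀ {x y} → Adj G x y → ℕ
    col-irrel : ∀ {x y} (p q : Adj G x y) → col p ≡ col q
    col-sym   : ∀ {x y} (p : Adj G x y) → col (sym G p) ≡ col p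
    range     : ∀ {x y} (p : Adj G x y) → 1 ≤ col p × col p ≤ t
    surj      : ∀ k → 1 ≤ k → k ≤ t → ∃[ x ] ∃[ y ] Σ (Adj G x y) λ p → col p ≡ k
    proper    : ∀ {x y z} (p : Adj G x y) (q : Adj G x z) → y ≢ z → col p ≢ col q
    interval  : ∀ {x y z} (p : Adj G x y) (q : Adj G x z) k →
                col p ≤ k → k ≤ col q → ∃[ w ] Σ (Adj G x w) λ r → col r ≡ k

IntervalColorable : Graph → Set
IntervalColorable G = ∃[ t ] (1 ≤ t × IntervalColoring G t)

W≡ : Graph → ℕ → Set
W≡ G w = IntervalColoring G w × (∀ t → IntervalColoring G t → t ≤ w)

module Submission where

-- Write  tri n = 0 + 1 + ⋯ + (n-1),  so that  n(n+1)/2 = n + tri n.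
--
-- Necessity.  The n edges at a vertex have n distinct
-- colours in 1…t, so n ≤ t.  By the interval property the colours at a vertex occupy
-- a window of width n (each colour in between is realised by an edge of its own
-- direction).  Starting from an edge of colour 1 at x₀, induction on the Hamming
-- distance k from x₀ shows that every edge at distance k has colour at most
-- (k+1)·n − tri (k+1): a vertex at distance k+1 has k+1 neighbours closer to x₀,
-- joined to it by edges of distinct colours, so one of them is small.  Maximising
-- over 0 ≤ k ≤ n bounds the colour t by n + tri n.
--
-- Sufficiency.  A parameter vector cs ∈ Bool^n determines a colouring in which the
-- colours at a vertex x are exactly  offset cs x + 1, …, offset cs x + n.  It is built
-- along Q (n+1) = Q n × K₂: the new perfect matching gets the colour just above the old
-- window, and the copy b = 1 is shifted up by n+1 when the parameter bit is set.
-- The number of colours is  n + Σ_{cs_i set} i,  and a greedy choice of cs hits every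
-- value between n and n + tri n.

open import Defs hiding (sym)
open import Data.Nat
open import Data.Nat.Properties
open import Data.Nat.DivMod using (m*n/n≡m)
open import Data.Nat.Tactic.RingSolver using (solve-∀)
open import Data.Fin using (Fin; toℕ; fromℕ<)
import Data.Fin as F
import Data.Fin.Properties as FP
open import Data.Bool using (Bool; true; false; not)
open import Data.Bool.Properties using (not-¬)
open import Data.Vec using (Vec; []; _∷_; replicate)
open import Data.Vec.Properties using (∷-injectiveˡ; ∷-injectiveʳ; ≡-dec)
open import Data.Product using (_×_; Σ; ∃-syntax; _,_; proj₁; proj₂; map₂; uncurry)
open import Data.Empty using (⊥-elim)
open import Relation.Binary.PropositionalEquality
open import Relation.Binary.PropositionalEquality.Properties using (subst-injective)
open import Relation.Nullary using (yes; no)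
open import Function.Bundles using (_⇔_; mk⇔)

-- Arithmetic

tri : ℕ → ℕ
tri zero    = 0
tri (suc n) = tri n + n

tri-double : ∀ n → tri n + tri n + n ≡ n * n
tri-double zero    = refl
tri-double (suc n) = begin
  tri n + n + (tri n + n) + suc n   ≡⟨ regroup (tri n) n ⟩
  (tri n + tri n + n) + (n + suc n) ≡⟨ cong (_+ (n + suc n)) (tri-double n) ⟩
  n * n + (n + suc n)               ≡⟨ square-suc n ⟩
  suc n * suc n                     ∎
  where
  open ≡-Reasoning
  regroup : ∀ a n → a + n + (a + n) + suc n ≡ (a + a + n) + (n + suc n)
  regroup = solve-∀
  square-suc : ∀ n → n * n + (n + suc n) ≡ suc n * suc n
  square-suc = solve-∀

half-n[n+1] : ∀ n → (n * suc n) / 2 ≡ n + tri n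
half-n[n+1] n = trans (cong (_/ 2) twice) (m*n/n≡m (n + tri n) 2)
  where
  open ≡-Reasoning
  expand : ∀ n → n * suc n ≡ n + n * n
  expand = solve-∀
  collect : ∀ n a → n + (a + a + n) ≡ (n + a) * 2
  collect = solve-∀
  twice : n * suc n ≡ (n + tri n) * 2
  twice = begin
    n * suc n               ≡⟨ expand n ⟩
    n + n * n               ≡⟨ cong (n +_) (sym (tri-double n)) ⟩
    n + (tri n + tri n + n) ≡⟨ collect n (tri n) ⟩
    (n + tri n) * 2         ∎

<⇒≤tri : ∀ {r n} → r < n → r ≤ tri n
<⇒≤tri {n = suc n} (s≤s r≤n) = ≤-trans r≤n (m≤n+m n (tri n))

-- The bound (d+1)·n − tri (d+1) obtained below at distance d from an edge of colour 1
-- never exceeds n + tri n for d ≤ n: it grows with d, by n − (d+1) ≥ 0 per step.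
distance-bound≤peak : ∀ n d → d ≤ n → suc d * n ≤ n + tri n + tri (suc d)
distance-bound≤peak n d d≤n = by-gap (n ∸ d) d (m+[n∸m]≡n d≤n)
  where
  at-peak : suc n * n ≡ n + tri n + tri (suc n)
  at-peak = trans (cong (n +_) (sym (tri-double n))) (regroup n (tri n))
    where
    regroup : ∀ n a → n + (a + a + n) ≡ n + a + (a + n)
    regroup = solve-∀
  by-gap : ∀ e d → d + e ≡ n → suc d * n ≤ n + tri n + tri (suc d)
  by-gap zero d d+0≡n with trans (sym (+-identityʳ d)) d+0≡n
  ... | refl = ≤-reflexive at-peak
  by-gap (suc e) d d+e≡n = +-cancelʳ-≤ n _ _ (begin
    suc d * n + n                        ≡⟨ +-comm (suc d * n) n ⟩
    suc (suc d) * n                      ≤⟨ by-gap e (suc d) (trans (sym (+-suc d e)) d+e≡n) ⟩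
    n + tri n + (tri d + d + suc d)      ≡⟨ sym (+-assoc (n + tri n) (tri d + d) (suc d)) ⟩
    n + tri n + (tri d + d) + suc d      ≤⟨ +-monoʳ-≤ (n + tri n + (tri d + d)) d<n ⟩
    n + tri n + (tri d + d) + n          ∎)
    where
    open ≤-Reasoning
    d<n : suc d ≤ n
    d<n = subst (suc d ≤_) d+e≡n (subst (_≤ d + suc e) (+-comm d 1) (+-monoʳ-≤ d (s≤s z≤n)))

-- Pigeonhole

distinct-in-window : ∀ {m} (f : Fin m → ℕ) → (∀ i j → f i ≡ f j → i ≡ j) →
  ∀ L w → (∀ i → L ≤ f i) → (∀ i → f i < L + w) → m ≤ w
distinct-in-window {m} f inj L w above below = FP.injective⇒≤ {f = slot} slot-injective
  where
  in-window : ∀ i → f i ∸ L < w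
  in-window i = +-cancelʳ-< L (f i ∸ L) w
    (subst₂ _<_ (sym (m∸n+n≡m (above i))) (+-comm L w) (below i))
  slot : Fin m → Fin w
  slot i = fromℕ< (in-window i)
  slot-injective : ∀ {i j} → slot i ≡ slot j → i ≡ j
  slot-injective {i} {j} e = inj i j (∸-cancelʳ-≡ (above i) (above j)
    (trans (sym (FP.toℕ-fromℕ< (in-window i)))
      (trans (cong toℕ e) (FP.toℕ-fromℕ< (in-window j)))))

distinct-has-small : ∀ {k} (f : Fin (suc k) → ℕ) → (∀ i j → f i ≡ f j → i ≡ j) →
  ∀ M → (∀ i → f i ≤ M) → ∃[ i ] f i + k ≤ M
distinct-has-small {k} f inj M bounded with FP.any? (λ i → f i + k ≤? M)
... | yes small = small
... | no none-small =
  ⊥-elim (1+n≰n (distinct-in-window (λ i → f i + k) shifted-injective (suc M) k large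
                   (λ i → s≤s (+-monoˡ-≤ k (bounded i)))))
  where
  shifted-injective : ∀ i j → f i + k ≡ f j + k → i ≡ j
  shifted-injective i j e = inj i j (+-cancelʳ-≡ k _ _ e)
  large : ∀ i → suc M ≤ f i + k
  large i = ≰⇒> (λ le → none-small (i , le))

-- Geometry of the hypercube

dir : ∀ {n} {x y : Vec Bool n} → Differ1 x y → Fin n
dir (here _ _)  = F.zero
dir (there _ d) = F.suc (dir d)

other-bit : ∀ {b c d : Bool} → b ≢ c → b ≢ d → c ≡ d
other-bit {true}  {true}           b≢c _   = ⊥-elim (b≢c refl)
other-bit {true}  {false} {true}   _   b≢d = ⊥-elim (b≢d refl)
other-bit {true}  {false} {false}  _   _   = refl
other-bit {false} {false}          b≢c _   = ⊥-elim (b≢c refl)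
other-bit {false} {true}  {false}  _   b≢d = ⊥-elim (b≢d refl)
other-bit {false} {true}  {true}   _   _   = refl

dir-injective : ∀ {n} {x y z : Vec Bool n} (p : Differ1 x y) (q : Differ1 x z) →
  dir p ≡ dir q → y ≡ z
dir-injective (here xs b≢c) (here .xs b≢d) _  = cong (_∷ xs) (other-bit b≢c b≢d)
dir-injective (there b p)   (there .b q)   e  = cong (b ∷_) (dir-injective p q (FP.suc-injective e))
dir-injective (here _ _)    (there _ _)    ()
dir-injective (there _ _)   (here _ _)     ()

flip : ∀ {n} → Fin n → Vec Bool n → Vec Bool n
flip F.zero    (b ∷ x) = not b ∷ x
flip (F.suc i) (b ∷ x) = b ∷ flip i x

flip-adj : ∀ {n} (i : Fin n) (x : Vec Bool n) → Differ1 x (flip i x)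
flip-adj F.zero    (b ∷ x) = here x (not-¬ refl)
flip-adj (F.suc i) (b ∷ x) = there b (flip-adj i x)

flip-injective : ∀ {n} (x : Vec Bool n) i j → flip i x ≡ flip j x → i ≡ j
flip-injective (b ∷ x) F.zero    F.zero    _ = refl
flip-injective (b ∷ x) F.zero    (F.suc j) e = ⊥-elim (not-¬ refl (sym (∷-injectiveˡ e)))
flip-injective (b ∷ x) (F.suc i) F.zero    e = ⊥-elim (not-¬ refl (∷-injectiveˡ e))
flip-injective (b ∷ x) (F.suc i) (F.suc j) e = cong F.suc (flip-injective x i j (∷-injectiveʳ e))

dist : ∀ {n} → Vec Bool n → Vec Bool n → ℕ
dist []         []          = 0
dist (true ∷ x)  (true ∷ y)  = dist x y
dist (false ∷ x) (false ∷ y) = dist x y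
dist (true ∷ x)  (false ∷ y) = suc (dist x y)
dist (false ∷ x) (true ∷ y)  = suc (dist x y)

dist≤ : ∀ {n} (x y : Vec Bool n) → dist x y ≤ n
dist≤ []          []          = z≤n
dist≤ (true ∷ x)  (true ∷ y)  = m≤n⇒m≤1+n (dist≤ x y)
dist≤ (false ∷ x) (false ∷ y) = m≤n⇒m≤1+n (dist≤ x y)
dist≤ (true ∷ x)  (false ∷ y) = s≤s (dist≤ x y)
dist≤ (false ∷ x) (true ∷ y)  = s≤s (dist≤ x y)

dist≡0⇒≡ : ∀ {n} (x y : Vec Bool n) → dist x y ≡ 0 → y ≡ x
dist≡0⇒≡ []          []          _ = refl
dist≡0⇒≡ (true ∷ x)  (true ∷ y)  e = cong (true ∷_) (dist≡0⇒≡ x y e)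
dist≡0⇒≡ (false ∷ x) (false ∷ y) e = cong (false ∷_) (dist≡0⇒≡ x y e)

towards : ∀ {n} (x y : Vec Bool n) → Fin (dist x y) → Vec Bool n
towards []          []          ()
towards (true ∷ x)  (true ∷ y)  i         = true ∷ towards x y i
towards (false ∷ x) (false ∷ y) i         = false ∷ towards x y i
towards (true ∷ x)  (false ∷ y) F.zero    = true ∷ y
towards (true ∷ x)  (false ∷ y) (F.suc i) = false ∷ towards x y i
towards (false ∷ x) (true ∷ y)  F.zero    = false ∷ y
towards (false ∷ x) (true ∷ y)  (F.suc i) = true ∷ towards x y i

towards-adj : ∀ {n} (x y : Vec Bool n) i → Differ1 y (towards x y i)
towards-adj []          []          ()
towards-adj (true ∷ x)  (true ∷ y)  i         = there true (towards-adj x y i)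
towards-adj (false ∷ x) (false ∷ y) i         = there false (towards-adj x y i)
towards-adj (true ∷ x)  (false ∷ y) F.zero    = here y (λ ())
towards-adj (true ∷ x)  (false ∷ y) (F.suc i) = there false (towards-adj x y i)
towards-adj (false ∷ x) (true ∷ y)  F.zero    = here y (λ ())
towards-adj (false ∷ x) (true ∷ y)  (F.suc i) = there true (towards-adj x y i)

towards-dist : ∀ {n} (x y : Vec Bool n) i → suc (dist x (towards x y i)) ≡ dist x y
towards-dist []          []          ()
towards-dist (true ∷ x)  (true ∷ y)  i         = towards-dist x y i
towards-dist (false ∷ x) (false ∷ y) i         = towards-dist x y i
towards-dist (true ∷ x)  (false ∷ y) F.zero    = refl
towards-dist (true ∷ x)  (false ∷ y) (F.suc i) = cong suc (towards-dist x y i)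
towards-dist (false ∷ x) (true ∷ y)  F.zero    = refl
towards-dist (false ∷ x) (true ∷ y)  (F.suc i) = cong suc (towards-dist x y i)

towards-injective : ∀ {n} (x y : Vec Bool n) i j → towards x y i ≡ towards x y j → i ≡ j
towards-injective []          []          () _ _
towards-injective (true ∷ x)  (true ∷ y)  i j e = towards-injective x y i j (∷-injectiveʳ e)
towards-injective (false ∷ x) (false ∷ y) i j e = towards-injective x y i j (∷-injectiveʳ e)
towards-injective (true ∷ x)  (false ∷ y) F.zero    F.zero    _ = refl
towards-injective (true ∷ x)  (false ∷ y) (F.suc i) (F.suc j) e =
  cong F.suc (towards-injective x y i j (∷-injectiveʳ e))
towards-injective (false ∷ x) (true ∷ y)  F.zero    F.zero    _ = refl
towards-injective (false ∷ x) (true ∷ y)  (F.suc i) (F.suc j) e =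
  cong F.suc (towards-injective x y i j (∷-injectiveʳ e))

-- Necessary conditions: every interval t-colouring of Q n has n ≤ t ≤ n + tri n

module Necessary {n t : ℕ} (C : IntervalColoring (Q n) t) where
  open IntervalColoring C

  same-end⇒same-colour : ∀ {x w w'} (r : Differ1 x w) (r' : Differ1 x w') → w ≡ w' → col r ≡ col r'
  same-end⇒same-colour r r' refl = col-irrel r r'

  same-colour⇒same-end : ∀ {x w w'} (r : Differ1 x w) (r' : Differ1 x w') → col r ≡ col r' → w ≡ w'
  same-colour⇒same-end {w = w} {w'} r r' e with ≡-dec Data.Bool._≟_ w w'
  ... | yes w≡w' = w≡w'
  ... | no  w≢w' = ⊥-elim (proper r r' w≢w' e)

  colours≥degree : n ≤ t
  colours≥degree = distinct-in-window colour-of colour-injective 1 t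
    (λ i → proj₁ (range (flip-adj i origin))) (λ i → s≤s (proj₂ (range (flip-adj i origin))))
    where
    origin : Vec Bool n
    origin = replicate n false
    colour-of : Fin n → ℕ
    colour-of i = col (flip-adj i origin)
    colour-injective : ∀ i j → colour-of i ≡ colour-of j → i ≡ j
    colour-injective i j e = flip-injective origin i j (same-colour⇒same-end _ _ e)

  -- The colours at a vertex lie in a window of width n: every colour between col p and
  -- col q is realised at x, by edges of pairwise distinct directions.
  spread : ∀ {x y z} (p : Differ1 x y) (q : Differ1 x z) → col q < col p + n
  spread p q with col p ≤? col q
  ... | no  q<p = ≤-trans (≰⇒> q<p) (m≤m+n (col p) n)
  ... | yes p≤q = subst (_< col p + n) (m+[n∸m]≡n p≤q) (+-monoʳ-< (col p) gap<n)
    where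
    gap : ℕ
    gap = col q ∸ col p
    between : ∀ (i : Fin (suc gap)) → col p + toℕ i ≤ col q
    between i = subst (col p + toℕ i ≤_) (m+[n∸m]≡n p≤q) (+-monoʳ-≤ (col p) (≤-pred (FP.toℕ<n i)))
    edge : ∀ (i : Fin (suc gap)) → ∃[ w ] Σ (Differ1 _ w) λ r → col r ≡ col p + toℕ i
    edge i = interval p q (col p + toℕ i) (m≤m+n _ _) (between i)
    direction : Fin (suc gap) → Fin n
    direction i = dir (proj₁ (proj₂ (edge i)))
    direction-injective : ∀ {i j} → direction i ≡ direction j → i ≡ j
    direction-injective {i} {j} e = FP.toℕ-injective (+-cancelˡ-≡ (col p) _ _
      (trans (sym (proj₂ (proj₂ (edge i))))
        (trans (same-end⇒same-colour _ _ (dir-injective _ _ e)) (proj₂ (proj₂ (edge j))))))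
    gap<n : suc gap ≤ n
    gap<n = FP.injective⇒≤ {f = direction} direction-injective

  step-bound : ∀ c a T k M → suc c ≤ a + n → a + T + k ≤ M → c + (T + suc k) ≤ n + M
  step-bound c a T k M c<a+n small = begin
    c + (T + suc k)     ≡⟨ shift c T k ⟩
    suc c + (T + k)     ≤⟨ +-monoˡ-≤ (T + k) c<a+n ⟩
    a + n + (T + k)     ≡⟨ regroup a n T k ⟩
    n + (a + T + k)     ≤⟨ +-monoʳ-≤ n small ⟩
    n + M               ∎
    where
    open ≤-Reasoning
    shift : ∀ c T k → c + (T + suc k) ≡ suc c + (T + k)
    shift = solve-∀
    regroup : ∀ a n T k → a + n + (T + k) ≡ n + (a + T + k)
    regroup = solve-∀

  distance-bound : ∀ {x₀ w₀} (p₀ : Differ1 x₀ w₀) → col p₀ ≡ 1 →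
    ∀ k y → dist x₀ y ≡ k → ∀ {w} (q : Differ1 y w) → col q + tri (suc k) ≤ suc k * n
  distance-bound {x₀} p₀ col≡1 zero y d≡0 q with dist≡0⇒≡ x₀ y d≡0
  ... | refl = subst₂ _≤_ (sym (+-identityʳ _)) (sym (+-identityʳ n))
                 (≤-pred (subst (col q <_) (cong (_+ n) col≡1) (spread p₀ q)))
  distance-bound {x₀} p₀ col≡1 (suc k) y d≡k+1 q
    with distinct-has-small closer-colour closer-injective (suc k * n) closer-bounded
    where
    closer : Fin (suc k) → Vec Bool n
    closer i = towards x₀ y (subst Fin (sym d≡k+1) i)
    closer-edge : ∀ i → Differ1 y (closer i)
    closer-edge i = towards-adj x₀ y _
    closer-colour : Fin (suc k) → ℕ
    closer-colour i = col (closer-edge i) + tri (suc k)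
    closer-injective : ∀ i j → closer-colour i ≡ closer-colour j → i ≡ j
    closer-injective i j e = subst-injective (sym d≡k+1)
      (towards-injective x₀ y _ _ (same-colour⇒same-end _ _ (+-cancelʳ-≡ (tri (suc k)) _ _ e)))
    closer-bounded : ∀ i → closer-colour i ≤ suc k * n
    closer-bounded i = subst (λ c → c + tri (suc k) ≤ suc k * n) (col-sym (closer-edge i))
      (distance-bound p₀ col≡1 k (closer i)
        (suc-injective (trans (towards-dist x₀ y _) d≡k+1)) (Differ1-sym (closer-edge i)))
  ... | i , small = step-bound (col q) _ (tri (suc k)) k (suc k * n)
                      (spread (towards-adj x₀ y (subst Fin (sym d≡k+1) i)) q) small

  -- Both bounds.  The colour t occurs at some distance d ≤ n from an edge of colour 1.
  bounds : 1 ≤ n → n ≤ t × t ≤ n + tri n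
  bounds 1≤n = colours≥degree , colours≤peak (surj 1 ≤-refl 1≤t) (surj t 1≤t ≤-refl)
    where
    1≤t : 1 ≤ t
    1≤t = ≤-trans 1≤n colours≥degree
    colours≤peak : (∃[ x ] ∃[ y ] Σ (Differ1 x y) λ p → col p ≡ 1) →
                   (∃[ x ] ∃[ y ] Σ (Differ1 x y) λ p → col p ≡ t) → t ≤ n + tri n
    colours≤peak (x₀ , _ , p₀ , col≡1) (x , _ , p , col≡t) =
      +-cancelʳ-≤ (tri (suc d)) t (n + tri n)
        (≤-trans (subst (λ c → c + tri (suc d) ≤ suc d * n) col≡t
                   (distance-bound p₀ col≡1 d x refl p))
                 (distance-bound≤peak n d (dist≤ x₀ x)))
      where
      d : ℕ
      d = dist x₀ x

-- Sufficiency: a family of interval colourings of Q n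

boost : Bool → Bool → ℕ → ℕ
boost true true k = k
boost _    _    _ = 0

boost≤ : ∀ c b k → boost c b k ≤ k
boost≤ true  true  k = ≤-refl
boost≤ true  false k = z≤n
boost≤ false b     k = z≤n

boost-mono : ∀ c b k → boost c b k ≤ boost c b (suc k)
boost-mono true  true  k = n≤1+n k
boost-mono true  false k = z≤n
boost-mono false b     k = z≤n

boost-suc : ∀ c b k → boost c b (suc k) ≤ suc (boost c b k)
boost-suc true  true  k = ≤-refl
boost-suc true  false k = z≤n
boost-suc false b     k = z≤n

boost-false : ∀ c k → boost c false k ≡ 0
boost-false true  k = refl
boost-false false k = refl

-- At a vertex x its colours are exactly
-- offset cs x + 1, …, offset cs x + n.  For Q (n+1) = Q n × K₂ the head edges (the new
-- matching) take the colour offset + n + 1 just above the old window, and edges in the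
-- copy b are shifted by n + 1 when c and b are both set.
offset : ∀ {n} → Vec Bool n → Vec Bool n → ℕ
offset []               []      = 0
offset {suc n} (c ∷ cs) (b ∷ x) = offset cs x + boost c b n

colour : ∀ {n} (cs : Vec Bool n) {x y : Vec Bool n} → Differ1 x y → ℕ
colour {suc n} (c ∷ cs) (here x _)  = offset cs x + suc n
colour {suc n} (c ∷ cs) (there b d) = colour cs d + boost c b (suc n)

-- The number of colours used:  n + Σ_{cs_i set} i.
span : ∀ {n} → Vec Bool n → ℕ
span []                   = 0
span {suc n} (true ∷ cs)  = span cs + suc n
span {suc n} (false ∷ cs) = span cs + 1

colour-window : ∀ {n} (cs : Vec Bool n) {x y} (p : Differ1 x y) →
  offset cs x < colour cs p × colour cs p ≤ offset cs x + n
colour-window {suc n} (c ∷ cs) (here {b = b} x _) =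
  +-monoʳ-< (offset cs x) (s≤s (boost≤ c b n)) ,
  +-monoˡ-≤ (suc n) (m≤m+n (offset cs x) (boost c b n))
colour-window {suc n} (c ∷ cs) {b ∷ x} (there b d) with colour-window cs d
... | lower , upper = +-mono-<-≤ lower (boost-mono c b n) , (begin
    colour cs d + boost c b (suc n)     ≤⟨ +-mono-≤ upper (boost-suc c b n) ⟩
    offset cs x + n + suc (boost c b n) ≡⟨ swap (offset cs x) n (boost c b n) ⟩
    offset cs x + boost c b n + suc n   ∎)
  where
  open ≤-Reasoning
  swap : ∀ a n s → a + n + suc s ≡ a + s + suc n
  swap = solve-∀

-- In an unshifted copy the head colour extends the window of Q n by one on top.
+0+suc : ∀ a n → a + 0 + suc n ≡ a + n + 1
+0+suc = solve-∀

offset-top : ∀ {n} (cs x : Vec Bool n) → offset cs x + n ≤ span cs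
offset-top []                  []          = z≤n
offset-top {suc n} (true ∷ cs)  (true ∷ x)  = +-monoˡ-≤ (suc n) (offset-top cs x)
offset-top {suc n} (true ∷ cs)  (false ∷ x) =
  +-monoˡ-≤ (suc n) (≤-trans (+-monoʳ-≤ (offset cs x) z≤n) (offset-top cs x))
offset-top {suc n} (false ∷ cs) (b ∷ x)     =
  subst (_≤ span cs + 1) (sym (+0+suc (offset cs x) n)) (+-monoˡ-≤ 1 (offset-top cs x))

offset-max : ∀ {n} (cs : Vec Bool n) → ∃[ u ] offset cs u + n ≡ span cs
offset-max []                 = [] , refl
offset-max {suc n} (true ∷ cs) with offset-max cs
... | u , top = (true ∷ u) , cong (_+ suc n) top
offset-max {suc n} (false ∷ cs) with offset-max cs
... | u , top = (false ∷ u) , trans (+0+suc (offset cs u) n) (cong (_+ 1) top)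

offset≤span-tail : ∀ {n} c (cs : Vec Bool n) x → offset (c ∷ cs) x ≤ span cs
offset≤span-tail {n} c cs (b ∷ x) =
  ≤-trans (+-monoʳ-≤ (offset cs x) (boost≤ c b n)) (offset-top cs x)

window-∸ : ∀ {B C s k} → B + s < k → k ≤ C + s → B < k ∸ s × k ∸ s ≤ C × k ∸ s + s ≡ k
window-∸ {B} {C} {s} {k} lo hi = +-cancelʳ-< s B (k ∸ s) (subst (B + s <_) (sym restore) lo)
                               , +-cancelʳ-≤ s (k ∸ s) C (subst (_≤ C + s) (sym restore) hi)
                               , restore
  where
  restore : k ∸ s + s ≡ k
  restore = m∸n+n≡m (≤-trans (m≤n+m s B) (<⇒≤ lo))

Realises : ∀ {n} → Vec Bool n → Vec Bool n → Set
Realises {n} cs x = ∀ k → offset cs x < k → k ≤ offset cs x + n →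
  ∃[ y ] Σ (Differ1 x y) λ r → colour cs r ≡ k

realises-unshifted : ∀ {n} c b (cs x : Vec Bool n) → (∀ k → boost c b k ≡ 0) →
  Realises cs x → Realises (c ∷ cs) (b ∷ x)
realises-unshifted {n} c b cs x unshifted realised k lo hi
  rewrite unshifted n | +-identityʳ (offset cs x) with k ≤? offset cs x + n
... | yes k≤top with realised k lo k≤top
...   | y , d , col≡k =
  (b ∷ y) , there b d , trans (cong (colour cs d +_) (unshifted (suc n))) (trans (+-identityʳ _) col≡k)
realises-unshifted {n} c b cs x unshifted realised k lo hi | no k>top =
  (not b ∷ x) , here x (not-¬ refl) ,
  ≤-antisym (subst (_≤ k) (sym (+-suc (offset cs x) n)) (≰⇒> k>top)) hi

colour-realises : ∀ {n} (cs x : Vec Bool n) → Realises cs x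
colour-realises []                 []          k lo hi = ⊥-elim (<⇒≱ lo hi)
colour-realises {suc n} (true ∷ cs) (false ∷ x) =
  realises-unshifted true false cs x (λ _ → refl) (colour-realises cs x)
colour-realises {suc n} (false ∷ cs) (b ∷ x)    =
  realises-unshifted false b cs x (λ _ → refl) (colour-realises cs x)
colour-realises {suc n} (true ∷ cs) (true ∷ x) k lo hi with k ≤? offset cs x + suc n
-- in the shifted copy the head colour closes the window from below
... | yes k≤head = (false ∷ x) , here x (λ ()) ,
  ≤-antisym (subst (_≤ k) (sym (+-suc (offset cs x) n)) lo) k≤head
... | no k>head with window-∸ (≰⇒> k>head) hi
...   | lo' , hi' , restore with colour-realises cs x (k ∸ suc n) lo' hi'
...     | y , d , col≡k∸s = (true ∷ y) , there true d , trans (cong (_+ suc n) col≡k∸s) restore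

unshifted-below-head : ∀ {n} (cs x : Vec Bool n) {y} (d : Differ1 x y) →
  colour cs d + 0 < offset cs x + suc n
unshifted-below-head {n} cs x d = ≤-<-trans
  (≤-trans (≤-reflexive (+-identityʳ _)) (proj₂ (colour-window cs d)))
  (+-monoʳ-< (offset cs x) ≤-refl)

head≢tail : ∀ {n} c (cs : Vec Bool n) b x {y} (d : Differ1 x y) →
  offset cs x + suc n ≢ colour cs d + boost c b (suc n)
head≢tail {n} true  cs true  x d eq = <⇒≢ (+-monoˡ-< (suc n) (proj₁ (colour-window cs d))) eq
head≢tail {n} true  cs false x d eq = <⇒≢ (unshifted-below-head cs x d) (sym eq)
head≢tail {n} false cs b     x d eq = <⇒≢ (unshifted-below-head cs x d) (sym eq)

colour-proper : ∀ {n} (cs : Vec Bool n) {x y z} (p : Differ1 x y) (q : Differ1 x z) →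
  y ≢ z → colour cs p ≢ colour cs q
colour-proper (c ∷ cs) (here x b≢c) (here .x b≢d) y≢z _  = y≢z (cong (_∷ x) (other-bit b≢c b≢d))
colour-proper (c ∷ cs) (here x _)   (there b q)   _      = head≢tail c cs b x q
colour-proper (c ∷ cs) (there b p)  (here x _)    _   eq = head≢tail c cs b x p (sym eq)
colour-proper (c ∷ cs) (there b p)  (there .b q)  y≢z eq =
  colour-proper cs p q (λ e → y≢z (cong (b ∷_) e)) (+-cancelʳ-≡ _ _ _ eq)

colour-irrel : ∀ {n} (cs : Vec Bool n) {x y} (p q : Differ1 x y) → colour cs p ≡ colour cs q
colour-irrel (c ∷ cs) (here x _)  (here .x _)  = refl
colour-irrel (c ∷ cs) (here x ne) (there b q)  = ⊥-elim (ne refl)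
colour-irrel (c ∷ cs) (there b p) (here x ne)  = ⊥-elim (ne refl)
colour-irrel (c ∷ cs) (there b p) (there .b q) = cong (_+ _) (colour-irrel cs p q)

colour-sym : ∀ {n} (cs : Vec Bool n) {x y} (p : Differ1 x y) → colour cs (Differ1-sym p) ≡ colour cs p
colour-sym (c ∷ cs) (here x _)  = refl
colour-sym (c ∷ cs) (there b p) = cong (_+ _) (colour-sym cs p)

-- Every colour 1, …, span cs occurs: small ones in the copy b = false, the others in
-- the window that ends at span cs.
colour-onto : ∀ {n} (cs : Vec Bool n) k → 1 ≤ k → k ≤ span cs →
  ∃[ x ] ∃[ y ] Σ (Differ1 x y) λ p → colour cs p ≡ k
colour-onto []                 k 1≤k k≤0 = ⊥-elim (<⇒≱ 1≤k k≤0)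
colour-onto {suc n} (c ∷ cs) k 1≤k k≤span with k ≤? span cs
... | yes k≤tail with colour-onto cs k 1≤k k≤tail
...   | x , y , d , col≡k =
  (false ∷ x) , (false ∷ y) , there false d ,
  trans (cong (colour cs d +_) (boost-false c (suc n))) (trans (+-identityʳ _) col≡k)
colour-onto {suc n} (c ∷ cs) k 1≤k k≤span | no k>tail with offset-max (c ∷ cs)
... | u , top = u , colour-realises (c ∷ cs) u k
  (≤-<-trans (offset≤span-tail c cs u) (≰⇒> k>tail)) (subst (k ≤_) (sym top) k≤span)

parametrised-colouring : ∀ {n} (cs : Vec Bool n) → IntervalColoring (Q n) (span cs)
parametrised-colouring cs = record
  { col       = colour cs
  ; col-irrel = colour-irrel cs
  ; col-sym   = colour-sym cs
  ; range     = λ {x} p → ≤-trans (s≤s z≤n) (proj₁ (colour-window cs p))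
                        , ≤-trans (proj₂ (colour-window cs p)) (offset-top cs x)
  ; surj      = colour-onto cs
  ; proper    = colour-proper cs
  ; interval  = λ {x} p q k p≤k k≤q → colour-realises cs x k
                  (<-≤-trans (proj₁ (colour-window cs p)) p≤k) (≤-trans k≤q (proj₂ (colour-window cs q)))
  }

choose : ∀ n → ℕ → Vec Bool n
choose zero    r = []
choose (suc n) r with n ≤? r
... | yes _ = true ∷ choose n (r ∸ n)
... | no  _ = false ∷ choose n r

span-choose : ∀ n r → r ≤ tri n → span (choose n r) ≡ n + r
span-choose zero    r r≤0 = sym (n≤0⇒n≡0 r≤0)
span-choose (suc n) r r≤tri with n ≤? r
... | yes n≤r = begin
    span (choose n (r ∸ n)) + suc n ≡⟨ cong (_+ suc n) (span-choose n (r ∸ n) rest≤tri) ⟩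
    n + (r ∸ n) + suc n             ≡⟨ cong (_+ suc n) (m+[n∸m]≡n n≤r) ⟩
    r + suc n                       ≡⟨ +-comm r (suc n) ⟩
    suc n + r                       ∎
  where
  open ≡-Reasoning
  rest≤tri : r ∸ n ≤ tri n
  rest≤tri = +-cancelʳ-≤ n (r ∸ n) (tri n) (subst (_≤ tri n + n) (sym (m∸n+n≡m n≤r)) r≤tri)
... | no n>r = trans (cong (_+ 1) (span-choose n r (<⇒≤tri (≰⇒> n>r)))) (+-comm (n + r) 1)

colouring-exists : ∀ n t → n ≤ t → t ≤ n + tri n → IntervalColoring (Q n) t
colouring-exists n t n≤t t≤peak = subst (IntervalColoring (Q n)) span≡t (parametrised-colouring cs)
  where
  cs : Vec Bool n
  cs = choose n (t ∸ n)
  span≡t : span cs ≡ t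
  span≡t = trans (span-choose n (t ∸ n)
                   (+-cancelˡ-≤ n (t ∸ n) (tri n) (subst (_≤ n + tri n) (sym (m+[n∸m]≡n n≤t)) t≤peak)))
                 (m+[n∸m]≡n n≤t)

mainTheorem1 : ∀ (n : ℕ) → 1 ≤ n →
    W≡ (Q n) ((n * suc n) / 2) ×
    (∀ (t : ℕ) → IntervalColoring (Q n) t ⇔ (n ≤ t × t ≤ (n * suc n) / 2))
mainTheorem1 n 1≤n =
  (sufficient n≤peak ≤-refl , λ t C → proj₂ (necessary C)) ,
  λ t → mk⇔ necessary (uncurry sufficient)
  where
  peak≡ : (n * suc n) / 2 ≡ n + tri n
  peak≡ = half-n[n+1] n
  n≤peak : n ≤ (n * suc n) / 2
  n≤peak = subst (n ≤_) (sym peak≡) (m≤m+n n (tri n))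
  necessary : ∀ {t} → IntervalColoring (Q n) t → n ≤ t × t ≤ (n * suc n) / 2
  necessary {t} C = map₂ (subst (t ≤_) (sym peak≡)) (Necessary.bounds C 1≤n)
  sufficient : ∀ {t} → n ≤ t → t ≤ (n * suc n) / 2 → IntervalColoring (Q n) t
  sufficient {t} n≤t t≤peak = colouring-exists n t n≤t (subst (t ≤_) peak≡ t≤peak)
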